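{- For every integer $n\ge1$, $|\mathbf{I}_n(101)| = |\mathbf{I}_n(110)|$.
   Context: An inversion sequence of length $n$ is an integer sequence $e=(e_1,\ldots,e_n)$ with $0 \le e_i < i$ for all $i$; $\mathbf{I}_n$ is the set of these. $\mathbf{I}_n(101)$ is the set of $e\in\mathbf{I}_n$ with no indices $i<j<k$ such that $e_i=e_k>e_j$; $\mathbf{I}_n(110)$ is the set of $e\in\mathbf{I}_n$ with no indices $i<j<k$ such that $e_i=e_j>e_k$. -}

module Defs where

open import Data.Nat using (ℕ; suc; _<_; _>_; _≡ᵇ_; _<ᵇ_)
open import Data.Fin using (Fin; toℕ; _<_)
open import Data.Vec using (Vec; lookup)
open import Data.Bool using (Bool; _∧_; not; T)
open import Data.List using (List; allFin)
open import Data.Bool.ListAction using (any; all)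
open import Data.Product using (Σ; _×_)

-- Inversion sequences of length n, stored 0-indexed: position i (0 ≤ i < n)
-- corresponds to the paper's index i+1, so the condition 0 ≤ e_{i+1} < i+1
-- reads  lookup e i < suc (toℕ i).  Bool-valued test (so the subtype below
-- has proof-irrelevant side conditions), plus the Set-level meaning.
isInversionSeq : {n : ℕ} → Vec ℕ n → Bool
isInversionSeq {n} e = all (λ i → lookup e i <ᵇ suc (toℕ i)) (allFin n)

IsInversionSeq : {n : ℕ} → Vec ℕ n → Set
IsInversionSeq e = T (isInversionSeq e)

contains101 : {n : ℕ} → Vec ℕ n → Bool
contains101 {n} e =
  any (λ i → any (λ j → any (λ k →
        (toℕ i <ᵇ toℕ j) ∧ (toℕ j <ᵇ toℕ k)
        ∧ (lookup e i ≡ᵇ lookup e k) ∧ (lookup e j <ᵇ lookup e i))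
      (allFin n)) (allFin n)) (allFin n)

contains110 : {n : ℕ} → Vec ℕ n → Bool
contains110 {n} e =
  any (λ i → any (λ j → any (λ k →
        (toℕ i <ᵇ toℕ j) ∧ (toℕ j <ᵇ toℕ k)
        ∧ (lookup e i ≡ᵇ lookup e j) ∧ (lookup e k <ᵇ lookup e i))
      (allFin n)) (allFin n)) (allFin n)

I[101] : ℕ → Set
I[101] n = Σ (Vec ℕ n) (λ e → IsInversionSeq e × T (not (contains101 e)))

I[110] : ℕ → Set
I[110] n = Σ (Vec ℕ n) (λ e → IsInversionSeq e × T (not (contains110 e)))

module Submission where

-- For a value v, the v-signature of a sequence e is the Boolean word obtained by
-- reading the entries of e that are ≤ v from left to right and recording whether
-- each one equals v.  An occurrence of 101 (e_i = e_k = v > e_j) or of 110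
-- (e_i = e_j = v > e_k) only involves entries ≤ v, so (Sections 1-6)
--   e avoids 101  iff  every v-signature lies in  F* (T T* F*)?
--   e avoids 110  iff  every v-signature lies in  F* (T F* T*)?.
-- The v-rotation of e (Sections 7-9) keeps e up to its first v and stably
-- regroups the later entries ≤ v inside their own positions, putting the v's
-- last (towards the 110 shape) or first (towards the 101 shape).  It leaves
-- the u-signatures for u ≠ v unchanged, preserves the inversion-sequence bounds,
-- and the two regroupings undo each other on words of the respective shapes.
-- Hence (Section 10) rotating towards 110 for v = 0, …, n-1 and rotating back
-- towards 101 for v = n-1, …, 0 are inverse bijections I_n(101) ↔ I_n(110)
-- (Section 11); values ≥ n never occur in an inversion sequence of length n.

open import Defs
open import Data.Nat using (ℕ; zero; suc; _+_; _≤_; _<_; _≥_; _≡ᵇ_; _<ᵇ_; z≤n; s≤s)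
open import Data.Nat.Properties
open import Data.Fin as Fin using (Fin; toℕ)
open import Data.Fin.Properties using (toℕ<n)
open import Data.Vec using (Vec; []; _∷_; lookup; toList)
open import Data.List using (List; []; _∷_; map; filter; length; drop; _++_; allFin)
open import Data.List.Properties using (map-tabulate; filter-accept; filter-reject; filter-idem; filter-++; filter-all; filter-none; ++-identityʳ; length-++; map-++)
open import Data.List.Relation.Unary.All as All using (All; []; _∷_)
open import Data.List.Relation.Unary.All.Properties using (all-filter; filter⁺; drop⁺; ++⁺)
open import Data.Bool using (Bool; true; false; _∧_; _∨_; not; T)
open import Data.Bool.Properties using (∧-zeroʳ; ∧-identityʳ; ∧-comm; ∨-conicalˡ; ∨-conicalʳ; not-injective; T-∧; T-not-≡; T-irrelevant)
open import Data.Bool.ListAction using (any; all; or; and)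
open import Data.Unit using (⊤; tt)
open import Data.Product using (Σ; _×_; _,_; proj₁; proj₂)
open import Relation.Nullary using (¬_; yes; no; contradiction)
open import Relation.Unary using (Decidable; ∁)
open import Relation.Unary.Properties using (∁?)
open import Relation.Binary using (Tri; tri<; tri≈; tri>)
open import Function using (_∘_; id)
open import Function.Bundles using (_↔_; mk↔ₛ′; Equivalence)
open import Relation.Binary.PropositionalEquality

-- Section 1.  Boolean comparisons, and searches over all positions.

true-if : ∀ {b} → T b → b ≡ true
true-if {true} _ = refl

false-if : ∀ {b} → ¬ T b → b ≡ false
false-if {true} ¬b = contradiction tt ¬b
false-if {false} _ = refl

≡ᵇ-refl : ∀ x → (x ≡ᵇ x) ≡ true
≡ᵇ-refl x = true-if (≡⇒≡ᵇ x x refl)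

≡ᵇ-≢ : ∀ {x y} → x ≢ y → (x ≡ᵇ y) ≡ false
≡ᵇ-≢ {x} {y} x≢y = false-if (x≢y ∘ ≡ᵇ⇒≡ x y)

<ᵇ-< : ∀ {x y} → x < y → (x <ᵇ y) ≡ true
<ᵇ-< x<y = true-if (<⇒<ᵇ x<y)

<ᵇ-≥ : ∀ {x y} → y ≤ x → (x <ᵇ y) ≡ false
<ᵇ-≥ {x} {y} y≤x = false-if (λ x<y → <⇒≱ (<ᵇ⇒< x y x<y) y≤x)

anyFin : ∀ {n} → (Fin n → Bool) → Bool
anyFin {n} g = any g (allFin n)

everyFin : ∀ {n} → (Fin n → Bool) → Bool
everyFin {n} g = all g (allFin n)

map-allFin-suc : ∀ {A : Set} {n} (g : Fin (suc n) → A) →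
                 map g (allFin (suc n)) ≡ g Fin.zero ∷ map (g ∘ Fin.suc) (allFin n)
map-allFin-suc g = cong (g Fin.zero ∷_) (trans (map-tabulate Fin.suc g) (sym (map-tabulate id (g ∘ Fin.suc))))

anyFin-suc : ∀ {n} (g : Fin (suc n) → Bool) → anyFin g ≡ g Fin.zero ∨ anyFin (g ∘ Fin.suc)
anyFin-suc g = cong or (map-allFin-suc g)

allFin-suc : ∀ {n} (g : Fin (suc n) → Bool) → everyFin g ≡ g Fin.zero ∧ everyFin (g ∘ Fin.suc)
allFin-suc g = cong and (map-allFin-suc g)

anyFin-cong : ∀ {n} {g h : Fin n → Bool} → (∀ i → g i ≡ h i) → anyFin g ≡ anyFin h
anyFin-cong {zero} _ = refl
anyFin-cong {suc n} {g} {h} g≗h = begin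
  anyFin g                          ≡⟨ anyFin-suc g ⟩
  g Fin.zero ∨ anyFin (g ∘ Fin.suc) ≡⟨ cong₂ _∨_ (g≗h Fin.zero) (anyFin-cong (g≗h ∘ Fin.suc)) ⟩
  h Fin.zero ∨ anyFin (h ∘ Fin.suc) ≡⟨ sym (anyFin-suc h) ⟩
  anyFin h                          ∎
  where open ≡-Reasoning

anyFin-false : ∀ {n} → anyFin {n} (λ _ → false) ≡ false
anyFin-false {zero} = refl
anyFin-false {suc n} = trans (anyFin-suc {n} (λ _ → false)) (anyFin-false {n})

anyFin-∧ˡ : ∀ {n} (c : Bool) (g : Fin n → Bool) → anyFin (λ k → c ∧ g k) ≡ c ∧ anyFin g
anyFin-∧ˡ true g = refl
anyFin-∧ˡ {n} false g = anyFin-false {n}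

anyFin-∧ʳ : ∀ {n} (g : Fin n → Bool) (c : Bool) → anyFin (λ k → g k ∧ c) ≡ anyFin g ∧ c
anyFin-∧ʳ g c = begin
  anyFin (λ k → g k ∧ c) ≡⟨ anyFin-cong (λ k → ∧-comm (g k) c) ⟩
  anyFin (λ k → c ∧ g k) ≡⟨ anyFin-∧ˡ c g ⟩
  c ∧ anyFin g           ≡⟨ ∧-comm c (anyFin g) ⟩
  anyFin g ∧ c           ∎
  where open ≡-Reasoning

-- Section 2.  Searching for increasing pairs and triples of positions.

anyPair : ∀ {n} → (Fin n → Fin n → Bool) → Bool
anyPair Q = anyFin λ j → anyFin λ k → (toℕ j <ᵇ toℕ k) ∧ Q j k

anyTriple : ∀ {n} → (Fin n → Fin n → Fin n → Bool) → Bool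
anyTriple R = anyFin λ i → anyFin λ j → anyFin λ k → (toℕ i <ᵇ toℕ j) ∧ (toℕ j <ᵇ toℕ k) ∧ R i j k

anyPair-suc : ∀ {n} (Q : Fin (suc n) → Fin (suc n) → Bool) →
              anyPair Q ≡ anyFin (λ k → Q Fin.zero (Fin.suc k)) ∨ anyPair (λ j k → Q (Fin.suc j) (Fin.suc k))
anyPair-suc {n} Q = trans (anyFin-suc (λ j → anyFin (test j)))
                      (cong₂ _∨_ (anyFin-suc (test Fin.zero)) (anyFin-cong λ j → anyFin-suc (test (Fin.suc j))))
  where
  test : Fin (suc n) → Fin (suc n) → Bool
  test j k = (toℕ j <ᵇ toℕ k) ∧ Q j k

anyTriple-suc : ∀ {n} (R : Fin (suc n) → Fin (suc n) → Fin (suc n) → Bool) →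
                anyTriple R ≡ anyPair (λ j k → R Fin.zero (Fin.suc j) (Fin.suc k))
                              ∨ anyTriple (λ i j k → R (Fin.suc i) (Fin.suc j) (Fin.suc k))
anyTriple-suc {n} R =
  trans (anyFin-suc (λ i → anyFin λ j → anyFin (test i j))) (cong₂ _∨_ startsAtZero startsLater)
  where
  test : Fin (suc n) → Fin (suc n) → Fin (suc n) → Bool
  test i j k = (toℕ i <ᵇ toℕ j) ∧ (toℕ j <ᵇ toℕ k) ∧ R i j k
  -- j = 0 is impossible (0 < j fails); the remaining pairs are shifted.
  startsAtZero : anyFin (λ j → anyFin (test Fin.zero j)) ≡ anyPair (λ j k → R Fin.zero (Fin.suc j) (Fin.suc k))
  startsAtZero = trans (anyFin-suc (λ j → anyFin (test Fin.zero j)))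
                   (trans (cong (_∨ anyFin (λ j → anyFin (test Fin.zero (Fin.suc j)))) (anyFin-false {suc n}))
                     (anyFin-cong λ j → anyFin-suc (test Fin.zero (Fin.suc j))))
  -- j = 0 and k = 0 are impossible (i < j, resp. j < k, fail).
  startsLater : anyFin (λ i → anyFin λ j → anyFin (test (Fin.suc i) j))
                ≡ anyTriple (λ i j k → R (Fin.suc i) (Fin.suc j) (Fin.suc k))
  startsLater = anyFin-cong λ i →
    trans (anyFin-suc (λ j → anyFin (test (Fin.suc i) j)))
      (trans (cong (_∨ anyFin (λ j → anyFin (test (Fin.suc i) (Fin.suc j)))) (anyFin-false {suc n}))
        (anyFin-cong λ j → trans (anyFin-suc (test (Fin.suc i) (Fin.suc j)))
                                 (cong (_∨ anyFin (test (Fin.suc i) (Fin.suc j) ∘ Fin.suc))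
                                       (∧-zeroʳ (toℕ i <ᵇ toℕ j)))))

-- Section 3.  Patterns of length three.

-- A pattern is a test on the values (e_i, e_j, e_k) at positions i < j < k.
Pattern : Set
Pattern = ℕ → ℕ → ℕ → Bool

p101 p110 : Pattern
p101 a b c = (a ≡ᵇ c) ∧ (b <ᵇ a)
p110 a b c = (a ≡ᵇ b) ∧ (c <ᵇ a)

-- contains101 e and contains110 e of Defs are, by definition, occurs p101 e and occurs p110 e.
occurs : ∀ {n} → Pattern → Vec ℕ n → Bool
occurs P e = anyTriple λ i j k → P (lookup e i) (lookup e j) (lookup e k)

occursAfter : ∀ {n} → Pattern → ℕ → Vec ℕ n → Bool
occursAfter P x xs = anyPair λ j k → P x (lookup xs j) (lookup xs k)

occurs-∷ : ∀ {n} P x (xs : Vec ℕ n) → occurs P (x ∷ xs) ≡ occursAfter P x xs ∨ occurs P xs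
occurs-∷ P x xs = anyTriple-suc λ i j k → P (lookup (x ∷ xs) i) (lookup (x ∷ xs) j) (lookup (x ∷ xs) k)

occursAfter-∷ : ∀ {n} P x y (ys : Vec ℕ n) →
                occursAfter P x (y ∷ ys) ≡ anyFin (λ k → P x y (lookup ys k)) ∨ occursAfter P x ys
occursAfter-∷ P x y ys = anyPair-suc λ j k → P x (lookup (y ∷ ys) j) (lookup (y ∷ ys) k)

-- Section 4.  Signatures.

atMost : ℕ → List ℕ → List ℕ
atMost v = filter (_≤? v)

filter-absorb : ∀ {P Q : ℕ → Set} (P? : Decidable P) (Q? : Decidable Q) → (∀ {x} → P x → Q x) →
                ∀ xs → filter P? (filter Q? xs) ≡ filter P? xs
filter-absorb P? Q? P⇒Q [] = refl
filter-absorb P? Q? P⇒Q (x ∷ xs) with Q? x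
... | yes _ with P? x
...   | yes _ = cong (x ∷_) (filter-absorb P? Q? P⇒Q xs)
...   | no _ = filter-absorb P? Q? P⇒Q xs
filter-absorb P? Q? P⇒Q (x ∷ xs) | no ¬qx with P? x
...   | yes px = contradiction (P⇒Q px) ¬qx
...   | no _ = filter-absorb P? Q? P⇒Q xs

atMost-atMost : ∀ {u v} → u ≤ v → ∀ xs → atMost u (atMost v xs) ≡ atMost u xs
atMost-atMost {u} {v} u≤v = filter-absorb (_≤? u) (_≤? v) (λ x≤u → ≤-trans x≤u u≤v)

atMost-∷-cong : ∀ u y {xs ys} → atMost u xs ≡ atMost u ys → atMost u (y ∷ xs) ≡ atMost u (y ∷ ys)
atMost-∷-cong u y eq with y ≤? u
... | yes y≤u = trans (filter-accept (_≤? u) y≤u) (trans (cong (y ∷_) eq) (sym (filter-accept (_≤? u) y≤u)))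
... | no y≰u = trans (filter-reject (_≤? u) y≰u) (trans eq (sym (filter-reject (_≤? u) y≰u)))

low : ∀ {n} → ℕ → Vec ℕ n → List ℕ
low v e = atMost v (toList e)

low-keep : ∀ {n x} v (xs : Vec ℕ n) → x ≤ v → low v (x ∷ xs) ≡ x ∷ low v xs
low-keep v xs x≤v = filter-accept (_≤? v) x≤v

low-skip : ∀ {n x} v (xs : Vec ℕ n) → v < x → low v (x ∷ xs) ≡ low v xs
low-skip v xs v<x = filter-reject (_≤? v) (<⇒≱ v<x)

signature : ∀ {n} → ℕ → Vec ℕ n → List Bool
signature v e = map (v ≡ᵇ_) (low v e)

signature-keep : ∀ {n x} v (xs : Vec ℕ n) → x ≤ v → signature v (x ∷ xs) ≡ (v ≡ᵇ x) ∷ signature v xs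
signature-keep v xs x≤v = cong (map (v ≡ᵇ_)) (low-keep v xs x≤v)

signature-skip : ∀ {n x} v (xs : Vec ℕ n) → v < x → signature v (x ∷ xs) ≡ signature v xs
signature-skip v xs v<x = cong (map (v ≡ᵇ_)) (low-skip v xs v<x)

signature-< : ∀ {n y} v (ys : Vec ℕ n) → y < v → signature v (y ∷ ys) ≡ false ∷ signature v ys
signature-< v ys y<v = trans (signature-keep v ys (<⇒≤ y<v)) (cong (_∷ signature v ys) (≡ᵇ-≢ (>⇒≢ y<v)))

signature-≡ : ∀ {n} v (ys : Vec ℕ n) → signature v (v ∷ ys) ≡ true ∷ signature v ys
signature-≡ v ys = trans (signature-keep v ys ≤-refl) (cong (_∷ signature v ys) (≡ᵇ-refl v))

signature-∷-cong : ∀ {n m} u x (ys : Vec ℕ n) (zs : Vec ℕ m) →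
                   signature u ys ≡ signature u zs → signature u (x ∷ ys) ≡ signature u (x ∷ zs)
signature-∷-cong u x ys zs eq with x ≤? u
... | yes x≤u = trans (signature-keep u ys x≤u) (trans (cong ((u ≡ᵇ x) ∷_) eq) (sym (signature-keep u zs x≤u)))
... | no x≰u = trans (signature-skip u ys (≰⇒> x≰u)) (trans eq (sym (signature-skip u zs (≰⇒> x≰u))))

-- Section 5.  Shapes of Boolean words.

allFalse allTrue : List Bool → Bool
allFalse [] = true
allFalse (false ∷ w) = allFalse w
allFalse (true ∷ w) = false
allTrue [] = true
allTrue (true ∷ w) = allTrue w
allTrue (false ∷ w) = false

truesThenFalses : List Bool → Bool
truesThenFalses [] = true
truesThenFalses (true ∷ w) = truesThenFalses w
truesThenFalses (false ∷ w) = allFalse w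

falsesThenTrues : List Bool → Bool
falsesThenTrues [] = true
falsesThenTrues (false ∷ w) = falsesThenTrues w
falsesThenTrues (true ∷ w) = allTrue w

afterFirstTrue : (List Bool → Bool) → List Bool → Bool
afterFirstTrue W [] = true
afterFirstTrue W (false ∷ w) = afterFirstTrue W w
afterFirstTrue W (true ∷ w) = W w

shape101 shape110 : List Bool → Bool
shape101 = afterFirstTrue truesThenFalses
shape110 = afterFirstTrue falsesThenTrues

SuffixClosed : (List Bool → Bool) → Set
SuffixClosed W = ∀ b w → W (b ∷ w) ≡ true → W w ≡ true

allFalse⇒truesThenFalses : ∀ w → allFalse w ≡ true → truesThenFalses w ≡ true
allFalse⇒truesThenFalses [] _ = refl
allFalse⇒truesThenFalses (false ∷ w) h = h

allTrue⇒falsesThenTrues : ∀ w → allTrue w ≡ true → falsesThenTrues w ≡ true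
allTrue⇒falsesThenTrues [] _ = refl
allTrue⇒falsesThenTrues (true ∷ w) h = h

truesThenFalses-suffix : SuffixClosed truesThenFalses
truesThenFalses-suffix true w h = h
truesThenFalses-suffix false w h = allFalse⇒truesThenFalses w h

falsesThenTrues-suffix : SuffixClosed falsesThenTrues
falsesThenTrues-suffix false w h = h
falsesThenTrues-suffix true w h = allTrue⇒falsesThenTrues w h

afterFirstTrue-of : ∀ {W} → SuffixClosed W → ∀ w → W w ≡ true → afterFirstTrue W w ≡ true
afterFirstTrue-of suffix [] _ = refl
afterFirstTrue-of suffix (false ∷ w) h = afterFirstTrue-of suffix w (suffix false w h)
afterFirstTrue-of suffix (true ∷ w) h = suffix true w h

afterFirstTrue-allFalse : ∀ W w → allFalse w ≡ true → afterFirstTrue W w ≡ true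
afterFirstTrue-allFalse W [] _ = refl
afterFirstTrue-allFalse W (false ∷ w) h = afterFirstTrue-allFalse W w h

-- Section 6.  Avoidance is a condition on signatures.

not-∨-absorb : ∀ {a b} → (a ≡ true → b ≡ true) → not a ∨ not b ≡ not a
not-∨-absorb {true} a⇒b rewrite a⇒b refl = refl
not-∨-absorb {false} _ = refl

hasValue-signature : ∀ {n} x (ys : Vec ℕ n) → anyFin (λ k → x ≡ᵇ lookup ys k) ≡ not (allFalse (signature x ys))
hasValue-signature x [] = refl
hasValue-signature x (y ∷ ys) rewrite anyFin-suc (λ k → x ≡ᵇ lookup (y ∷ ys) k) with <-cmp y x
... | tri< y<x _ _ rewrite ≡ᵇ-≢ (>⇒≢ y<x) | signature-< x ys y<x = hasValue-signature x ys
... | tri≈ _ refl _ rewrite ≡ᵇ-refl x | signature-≡ x ys = refl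
... | tri> _ _ x<y rewrite ≡ᵇ-≢ (<⇒≢ x<y) | signature-skip x ys x<y = hasValue-signature x ys

hasSmaller-signature : ∀ {n} x (ys : Vec ℕ n) → anyFin (λ k → lookup ys k <ᵇ x) ≡ not (allTrue (signature x ys))
hasSmaller-signature x [] = refl
hasSmaller-signature x (y ∷ ys) rewrite anyFin-suc (λ k → lookup (y ∷ ys) k <ᵇ x) with <-cmp y x
... | tri< y<x _ _ rewrite <ᵇ-< y<x | signature-< x ys y<x = refl
... | tri≈ _ refl _ rewrite <ᵇ-≥ (≤-refl {x}) | signature-≡ x ys = hasSmaller-signature x ys
... | tri> _ _ x<y rewrite <ᵇ-≥ (<⇒≤ x<y) | signature-skip x ys x<y = hasSmaller-signature x ys

-- An occurrence of 101 starting with x exists iff some later x comes after some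
-- later entry smaller than x, i.e. iff the x-signature of the rest is not T* F*.
occursAfter-101 : ∀ {n} x (ys : Vec ℕ n) → occursAfter p101 x ys ≡ not (truesThenFalses (signature x ys))
occursAfter-101 x [] = refl
occursAfter-101 x (y ∷ ys) = begin
  occursAfter p101 x (y ∷ ys)
    ≡⟨ occursAfter-∷ p101 x y ys ⟩
  anyFin (λ k → (x ≡ᵇ lookup ys k) ∧ (y <ᵇ x)) ∨ occursAfter p101 x ys
    ≡⟨ cong₂ _∨_ (trans (anyFin-∧ʳ (λ k → x ≡ᵇ lookup ys k) (y <ᵇ x)) (cong (_∧ (y <ᵇ x)) (hasValue-signature x ys)))
                 (occursAfter-101 x ys) ⟩
  (not (allFalse s) ∧ (y <ᵇ x)) ∨ not (truesThenFalses s)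
    ≡⟨ byHead (<-cmp y x) ⟩
  not (truesThenFalses (signature x (y ∷ ys))) ∎
  where
  open ≡-Reasoning
  s : List Bool
  s = signature x ys
  byHead : Tri (y < x) (y ≡ x) (x < y) →
           (not (allFalse s) ∧ (y <ᵇ x)) ∨ not (truesThenFalses s) ≡ not (truesThenFalses (signature x (y ∷ ys)))
  byHead (tri< y<x _ _) rewrite <ᵇ-< y<x | signature-< x ys y<x =
    trans (cong (_∨ not (truesThenFalses s)) (∧-identityʳ _)) (not-∨-absorb (allFalse⇒truesThenFalses s))
  byHead (tri≈ _ refl _) rewrite <ᵇ-≥ (≤-refl {y}) | signature-≡ x ys =
    cong (_∨ not (truesThenFalses s)) (∧-zeroʳ _)
  byHead (tri> _ _ x<y) rewrite <ᵇ-≥ (<⇒≤ x<y) | signature-skip x ys x<y =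
    cong (_∨ not (truesThenFalses s)) (∧-zeroʳ _)

-- An occurrence of 110 starting with x exists iff some later x is followed by an
-- entry smaller than x, i.e. iff the x-signature of the rest is not F* T*.
occursAfter-110 : ∀ {n} x (ys : Vec ℕ n) → occursAfter p110 x ys ≡ not (falsesThenTrues (signature x ys))
occursAfter-110 x [] = refl
occursAfter-110 x (y ∷ ys) = begin
  occursAfter p110 x (y ∷ ys)
    ≡⟨ occursAfter-∷ p110 x y ys ⟩
  anyFin (λ k → (x ≡ᵇ y) ∧ (lookup ys k <ᵇ x)) ∨ occursAfter p110 x ys
    ≡⟨ cong₂ _∨_ (trans (anyFin-∧ˡ (x ≡ᵇ y) (λ k → lookup ys k <ᵇ x)) (cong ((x ≡ᵇ y) ∧_) (hasSmaller-signature x ys)))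
                 (occursAfter-110 x ys) ⟩
  ((x ≡ᵇ y) ∧ not (allTrue s)) ∨ not (falsesThenTrues s)
    ≡⟨ byHead (<-cmp y x) ⟩
  not (falsesThenTrues (signature x (y ∷ ys))) ∎
  where
  open ≡-Reasoning
  s : List Bool
  s = signature x ys
  byHead : Tri (y < x) (y ≡ x) (x < y) →
           ((x ≡ᵇ y) ∧ not (allTrue s)) ∨ not (falsesThenTrues s) ≡ not (falsesThenTrues (signature x (y ∷ ys)))
  byHead (tri< y<x _ _) rewrite ≡ᵇ-≢ (>⇒≢ y<x) | signature-< x ys y<x = refl
  byHead (tri≈ _ refl _) rewrite ≡ᵇ-refl x | signature-≡ x ys = not-∨-absorb (allTrue⇒falsesThenTrues s)
  byHead (tri> _ _ x<y) rewrite ≡ᵇ-≢ (<⇒≢ x<y) | signature-skip x ys x<y = refl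

occurs-∷-false : ∀ {n} P x (xs : Vec ℕ n) → occurs P (x ∷ xs) ≡ false →
                 occursAfter P x xs ≡ false × occurs P xs ≡ false
occurs-∷-false P x xs h = ∨-conicalˡ _ _ h′ , ∨-conicalʳ _ _ h′
  where
  h′ : occursAfter P x xs ∨ occurs P xs ≡ false
  h′ = trans (sym (occurs-∷ P x xs)) h

-- Adding an entry x ≠ v in front only adds a leading F (or nothing) to the v-signature.
afterFirstTrue-∷-other : ∀ {n} W {x v} (xs : Vec ℕ n) → x ≢ v →
                         afterFirstTrue W (signature v (x ∷ xs)) ≡ afterFirstTrue W (signature v xs)
afterFirstTrue-∷-other W {x} {v} xs x≢v with <-cmp x v
... | tri< x<v _ _ = cong (afterFirstTrue W) (signature-< v xs x<v)
... | tri≈ _ x≡v _ = contradiction x≡v x≢v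
... | tri> _ _ v<x = cong (afterFirstTrue W) (signature-skip v xs v<x)

module Avoidance (P : Pattern) (W : List Bool → Bool) (W-suffix : SuffixClosed W)
                 (occursAfter-W : ∀ {n} x (xs : Vec ℕ n) → occursAfter P x xs ≡ not (W (signature x xs))) where

  avoids⇒shape : ∀ {n} (e : Vec ℕ n) → occurs P e ≡ false → ∀ v → afterFirstTrue W (signature v e) ≡ true
  avoids⇒shape [] _ v = refl
  avoids⇒shape (x ∷ xs) h v with occurs-∷-false P x xs h | x ≟ v
  ... | noneAfter , _ | yes refl =
        trans (cong (afterFirstTrue W) (signature-≡ x xs)) (not-injective (trans (sym (occursAfter-W x xs)) noneAfter))
  ... | _ , noneInTail | no x≢v = trans (afterFirstTrue-∷-other W xs x≢v) (avoids⇒shape xs noneInTail v)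

  shape⇒avoids : ∀ {n} (e : Vec ℕ n) → (∀ v → afterFirstTrue W (signature v e) ≡ true) → occurs P e ≡ false
  shape⇒avoids [] _ = refl
  shape⇒avoids (x ∷ xs) h = begin
    occurs P (x ∷ xs)                ≡⟨ occurs-∷ P x xs ⟩
    occursAfter P x xs ∨ occurs P xs ≡⟨ cong₂ _∨_ (trans (occursAfter-W x xs) (cong not atHead)) (shape⇒avoids xs inTail) ⟩
    false                            ∎
    where
    open ≡-Reasoning
    atHead : W (signature x xs) ≡ true
    atHead = trans (cong (afterFirstTrue W) (sym (signature-≡ x xs))) (h x)
    inTail : ∀ v → afterFirstTrue W (signature v xs) ≡ true
    inTail v with x ≟ v
    ... | yes refl = afterFirstTrue-of W-suffix (signature x xs) atHead
    ... | no x≢v = trans (sym (afterFirstTrue-∷-other W xs x≢v)) (h v)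

module Avoid101 = Avoidance p101 truesThenFalses truesThenFalses-suffix occursAfter-101
module Avoid110 = Avoidance p110 falsesThenTrues falsesThenTrues-suffix occursAfter-110

-- Section 7.  Refilling the entries at most v.

headOr : ℕ → List ℕ → ℕ
headOr d [] = d
headOr d (y ∷ _) = y

-- Replace, from left to right, the entries of e that are ≤ v by the successive
-- elements of q.  It is used with lists q of values ≤ v of length |low v e|.
refill : ∀ {n} → ℕ → Vec ℕ n → List ℕ → Vec ℕ n
refill v [] q = []
refill v (x ∷ xs) q with x ≤? v
... | yes _ = headOr x q ∷ refill v xs (drop 1 q)
... | no _ = x ∷ refill v xs q

Fits : ∀ {n} → ℕ → Vec ℕ n → List ℕ → Set
Fits v e q = All (_≤ v) q × length q ≡ length (low v e)

fits-keep : ∀ {n x y v} (xs : Vec ℕ n) {q} → x ≤ v → Fits v (x ∷ xs) (y ∷ q) → y ≤ v × Fits v xs q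
fits-keep xs x≤v (y≤v ∷ q≤v , len) = y≤v , q≤v , suc-injective (trans len (cong length (low-keep _ xs x≤v)))

fits-skip : ∀ {n x v} (xs : Vec ℕ n) {q} → v < x → Fits v (x ∷ xs) q → Fits v xs q
fits-skip xs v<x (q≤v , len) = q≤v , trans len (cong length (low-skip _ xs v<x))

fits-nonempty : ∀ {n x v} (xs : Vec ℕ n) → x ≤ v → ¬ Fits v (x ∷ xs) []
fits-nonempty xs x≤v (_ , len) = 0≢1+n (trans len (cong length (low-keep _ xs x≤v)))

low-refill : ∀ {n} v (xs : Vec ℕ n) q → Fits v xs q → low v (refill v xs q) ≡ q
low-refill v [] [] _ = refl
low-refill v (x ∷ xs) q fits with x ≤? v
low-refill v (x ∷ xs) [] fits | yes x≤v = contradiction fits (fits-nonempty xs x≤v)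
low-refill v (x ∷ xs) (y ∷ q) fits | yes x≤v with fits-keep xs x≤v fits
... | y≤v , fits′ = trans (low-keep v (refill v xs q) y≤v) (cong (y ∷_) (low-refill v xs q fits′))
low-refill v (x ∷ xs) q fits | no x≰v =
  trans (low-skip v (refill v xs q) (≰⇒> x≰v)) (low-refill v xs q (fits-skip xs (≰⇒> x≰v) fits))

refill-low : ∀ {n} v (xs : Vec ℕ n) → refill v xs (low v xs) ≡ xs
refill-low v [] = refl
refill-low v (x ∷ xs) with x ≤? v
... | yes x≤v rewrite low-keep v xs x≤v = cong (x ∷_) (refill-low v xs)
... | no x≰v rewrite low-skip v xs (≰⇒> x≰v) = cong (x ∷_) (refill-low v xs)

headOr-≤ : ∀ {x v} q → x ≤ v → All (_≤ v) q → headOr x q ≤ v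
headOr-≤ [] x≤v _ = x≤v
headOr-≤ (y ∷ q) _ (y≤v ∷ _) = y≤v

refill-refill : ∀ {n} v (xs : Vec ℕ n) q q′ → All (_≤ v) q → Fits v xs q′ →
                refill v (refill v xs q) q′ ≡ refill v xs q′
refill-refill v [] q q′ _ _ = refl
refill-refill v (x ∷ xs) q q′ q≤v fits with x ≤? v
refill-refill v (x ∷ xs) q [] q≤v fits | yes x≤v = contradiction fits (fits-nonempty xs x≤v)
refill-refill v (x ∷ xs) q (y ∷ q′) q≤v fits | yes x≤v with headOr x q ≤? v
... | yes _ = cong (y ∷_) (refill-refill v xs (drop 1 q) q′ (drop⁺ 1 q≤v) (fits-keep xs x≤v fits .proj₂))
... | no h≰v = contradiction (headOr-≤ q x≤v q≤v) h≰v
refill-refill v (x ∷ xs) q q′ q≤v fits | no x≰v with x ≤? v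
... | yes x≤v = contradiction x≤v x≰v
... | no _ = cong (x ∷_) (refill-refill v xs q q′ q≤v (fits-skip xs (≰⇒> x≰v) fits))

low-refill-below : ∀ {n u v} → u < v → (xs : Vec ℕ n) → ∀ q → Fits v xs q → low u (refill v xs q) ≡ atMost u q
low-refill-below u<v [] [] _ = refl
low-refill-below {v = v} u<v (x ∷ xs) q fits with x ≤? v
low-refill-below u<v (x ∷ xs) [] fits | yes x≤v = contradiction fits (fits-nonempty xs x≤v)
low-refill-below {u = u} u<v (x ∷ xs) (y ∷ q) fits | yes x≤v =
  atMost-∷-cong u y (low-refill-below u<v xs q (fits-keep xs x≤v fits .proj₂))
low-refill-below {u = u} u<v (x ∷ xs) q fits | no x≰v =
  trans (low-skip u (refill _ xs q) (<-trans u<v (≰⇒> x≰v))) (low-refill-below u<v xs q (fits-skip xs (≰⇒> x≰v) fits))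

-- For u > v, refilling with values ≤ v does not change the u-signature:
-- refilled positions stay below u.
signature-refill-above : ∀ {n u v} → v < u → (xs : Vec ℕ n) → ∀ q → All (_≤ v) q →
                         signature u (refill v xs q) ≡ signature u xs
signature-refill-above v<u [] q _ = refl
signature-refill-above {u = u} {v} v<u (x ∷ xs) q q≤v with x ≤? v
... | yes x≤v = begin
  signature u (headOr x q ∷ refill v xs (drop 1 q)) ≡⟨ signature-< u _ (≤-<-trans (headOr-≤ q x≤v q≤v) v<u) ⟩
  false ∷ signature u (refill v xs (drop 1 q))       ≡⟨ cong (false ∷_) (signature-refill-above v<u xs (drop 1 q) (drop⁺ 1 q≤v)) ⟩
  false ∷ signature u xs                             ≡⟨ sym (signature-< u xs (≤-<-trans x≤v v<u)) ⟩
  signature u (x ∷ xs)                               ∎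
  where open ≡-Reasoning
... | no _ = signature-∷-cong u x (refill v xs q) xs (signature-refill-above v<u xs q q≤v)

-- Section 8.  Regrouping the copies of a value.

copies others : ℕ → List ℕ → List ℕ
copies v = filter (v ≟_)
others v = filter (∁? (v ≟_))

copiesLast copiesFirst : ℕ → List ℕ → List ℕ
copiesLast v w = others v w ++ copies v w
copiesFirst v w = copies v w ++ others v w

record Regrouping (s : ℕ → List ℕ → List ℕ) : Set where
  field
    length-regroup : ∀ v w → length (s v w) ≡ length w
    bound-regroup : ∀ v w → All (_≤ v) w → All (_≤ v) (s v w)
    below-regroup : ∀ {u v} → u < v → ∀ w → atMost u (s v w) ≡ atMost u w

length-copies-others : ∀ v w → length (copies v w) + length (others v w) ≡ length w
length-copies-others v [] = refl
length-copies-others v (x ∷ w) with v ≟ x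
... | yes v≡x = trans (cong₂ (λ a b → length a + length b) (filter-accept (v ≟_) v≡x)
                                                           (filter-reject (∁? (v ≟_)) (λ v≢x → v≢x v≡x)))
                      (cong suc (length-copies-others v w))
... | no v≢x = trans (cong₂ (λ a b → length a + length b) (filter-reject (v ≟_) v≢x) (filter-accept (∁? (v ≟_)) v≢x))
                     (trans (+-suc _ _) (cong suc (length-copies-others v w)))

copies-equal : ∀ v w → All (v ≡_) (copies v w)
copies-equal v = all-filter (v ≟_)

others-unequal : ∀ v w → All (∁ (v ≡_)) (others v w)
others-unequal v = all-filter (∁? (v ≟_))

atMost-copies : ∀ {u v} → u < v → ∀ w → atMost u (copies v w) ≡ []
atMost-copies {u} u<v w = filter-none (_≤? u) (All.map (λ { refl x≤u → <⇒≱ u<v x≤u }) (copies-equal _ w))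

atMost-others : ∀ {u v} → u < v → ∀ w → atMost u (others v w) ≡ atMost u w
atMost-others {u} {v} u<v = filter-absorb (_≤? u) (∁? (v ≟_)) (λ { x≤u refl → <⇒≱ u<v x≤u })

regroup-bound : ∀ {v} w → All (_≤ v) w → All (_≤ v) (copies v w) × All (_≤ v) (others v w)
regroup-bound {v} w w≤v = filter⁺ (v ≟_) w≤v , filter⁺ (∁? (v ≟_)) w≤v

copiesLast-regrouping : Regrouping copiesLast
copiesLast-regrouping = record
  { length-regroup = λ v w → trans (length-++ (others v w)) (trans (+-comm (length (others v w)) _) (length-copies-others v w))
  ; bound-regroup = λ v w w≤v → ++⁺ (regroup-bound w w≤v .proj₂) (regroup-bound w w≤v .proj₁)
  ; below-regroup = λ u<v w → trans (filter-++ (_≤? _) (others _ w) (copies _ w))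
                      (trans (cong₂ _++_ (atMost-others u<v w) (atMost-copies u<v w)) (++-identityʳ _))
  }

copiesFirst-regrouping : Regrouping copiesFirst
copiesFirst-regrouping = record
  { length-regroup = λ v w → trans (length-++ (copies v w)) (length-copies-others v w)
  ; bound-regroup = λ v w w≤v → ++⁺ (regroup-bound w w≤v .proj₁) (regroup-bound w w≤v .proj₂)
  ; below-regroup = λ u<v w → trans (filter-++ (_≤? _) (copies _ w) (others _ w))
                      (cong₂ _++_ (atMost-copies u<v w) (atMost-others u<v w))
  }

copies-others : ∀ v w → copies v (others v w) ≡ []
copies-others v w = filter-none (v ≟_) (others-unequal v w)

others-copies : ∀ v w → others v (copies v w) ≡ []
others-copies v w = filter-none (∁? (v ≟_)) (All.map (λ v≡x v≢x → v≢x v≡x) (copies-equal v w))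

copiesFirst-copiesLast : ∀ v w → copiesFirst v (copiesLast v w) ≡ copiesFirst v w
copiesFirst-copiesLast v w = cong₂ _++_
  (trans (filter-++ (v ≟_) (others v w) (copies v w))
         (cong₂ _++_ (copies-others v w) (filter-idem (v ≟_) w)))
  (trans (filter-++ (∁? (v ≟_)) (others v w) (copies v w))
         (trans (cong₂ _++_ (filter-idem (∁? (v ≟_)) w) (others-copies v w)) (++-identityʳ (others v w))))

copiesLast-copiesFirst : ∀ v w → copiesLast v (copiesFirst v w) ≡ copiesLast v w
copiesLast-copiesFirst v w = cong₂ _++_
  (trans (filter-++ (∁? (v ≟_)) (copies v w) (others v w))
         (cong₂ _++_ (others-copies v w) (filter-idem (∁? (v ≟_)) w)))
  (trans (filter-++ (v ≟_) (copies v w) (others v w))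
         (trans (cong₂ _++_ (filter-idem (v ≟_) w) (copies-others v w)) (++-identityʳ (copies v w))))

allTrue-map : ∀ {v} w → All (v ≡_) w → allTrue (map (v ≡ᵇ_) w) ≡ true
allTrue-map [] [] = refl
allTrue-map (x ∷ w) (refl ∷ h) rewrite ≡ᵇ-refl x = allTrue-map w h

allFalse-map : ∀ {v} w → All (∁ (v ≡_)) w → allFalse (map (v ≡ᵇ_) w) ≡ true
allFalse-map [] [] = refl
allFalse-map (x ∷ w) (v≢x ∷ h) rewrite ≡ᵇ-≢ v≢x = allFalse-map w h

allTrue-map⁻ : ∀ v w → allTrue (map (v ≡ᵇ_) w) ≡ true → All (v ≡_) w
allTrue-map⁻ v [] _ = []
allTrue-map⁻ v (x ∷ w) h with v ≡ᵇ x in eq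
... | true = ≡ᵇ⇒≡ v x (subst T (sym eq) tt) ∷ allTrue-map⁻ v w h

allFalse-map⁻ : ∀ v w → allFalse (map (v ≡ᵇ_) w) ≡ true → All (∁ (v ≡_)) w
allFalse-map⁻ v [] _ = []
allFalse-map⁻ v (x ∷ w) h with v ≡ᵇ x in eq
... | false = (λ v≡x → subst T eq (≡⇒≡ᵇ v x v≡x)) ∷ allFalse-map⁻ v w h

truesThenFalses-++ : ∀ a b → allTrue a ≡ true → allFalse b ≡ true → truesThenFalses (a ++ b) ≡ true
truesThenFalses-++ [] b _ hb = allFalse⇒truesThenFalses b hb
truesThenFalses-++ (true ∷ a) b ha hb = truesThenFalses-++ a b ha hb

falsesThenTrues-++ : ∀ a b → allFalse a ≡ true → allTrue b ≡ true → falsesThenTrues (a ++ b) ≡ true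
falsesThenTrues-++ [] b _ hb = allTrue⇒falsesThenTrues b hb
falsesThenTrues-++ (false ∷ a) b ha hb = falsesThenTrues-++ a b ha hb

copiesLast-shape : ∀ v w → falsesThenTrues (map (v ≡ᵇ_) (copiesLast v w)) ≡ true
copiesLast-shape v w = trans (cong falsesThenTrues (map-++ (v ≡ᵇ_) (others v w) (copies v w)))
  (falsesThenTrues-++ (map (v ≡ᵇ_) (others v w)) (map (v ≡ᵇ_) (copies v w))
                      (allFalse-map _ (others-unequal v w)) (allTrue-map _ (copies-equal v w)))

copiesFirst-shape : ∀ v w → truesThenFalses (map (v ≡ᵇ_) (copiesFirst v w)) ≡ true
copiesFirst-shape v w = trans (cong truesThenFalses (map-++ (v ≡ᵇ_) (copies v w) (others v w)))
  (truesThenFalses-++ (map (v ≡ᵇ_) (copies v w)) (map (v ≡ᵇ_) (others v w))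
                      (allTrue-map _ (copies-equal v w)) (allFalse-map _ (others-unequal v w)))

-- ... and a list whose word already has that shape is left unchanged.  (Filtering
-- by v ≟_ computes with v ≡ᵇ x, so splitting on v ≡ᵇ x unfolds both filters.)
copiesLast-fixed : ∀ v w → falsesThenTrues (map (v ≡ᵇ_) w) ≡ true → copiesLast v w ≡ w
copiesLast-fixed v [] _ = refl
copiesLast-fixed v (x ∷ w) h with v ≡ᵇ x
... | false = cong (x ∷_) (copiesLast-fixed v w h)
... | true = cong₂ _++_ (filter-none (∁? (v ≟_)) (All.map (λ v≡x v≢x → v≢x v≡x) (allTrue-map⁻ v w h)))
                        (cong (x ∷_) (filter-all (v ≟_) (allTrue-map⁻ v w h)))

copiesFirst-fixed : ∀ v w → truesThenFalses (map (v ≡ᵇ_) w) ≡ true → copiesFirst v w ≡ w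
copiesFirst-fixed v [] _ = refl
copiesFirst-fixed v (x ∷ w) h with v ≡ᵇ x
... | true = cong (x ∷_) (copiesFirst-fixed v w h)
... | false = cong₂ _++_ (filter-none (v ≟_) (allFalse-map⁻ v w h))
                         (cong (x ∷_) (filter-all (∁? (v ≟_)) (allFalse-map⁻ v w h)))

-- Section 9.  Rotations.

Bounded : ∀ {n} → (Fin n → ℕ) → Vec ℕ n → Set
Bounded f [] = ⊤
Bounded f (x ∷ xs) = x < f Fin.zero × Bounded (f ∘ Fin.suc) xs

Monotone : ∀ {n} → (Fin n → ℕ) → Set
Monotone f = ∀ i j → toℕ i ≤ toℕ j → f i ≤ f j

refill-bounded : ∀ {n} {f : Fin n → ℕ} {v} → (∀ i → v < f i) →
                 (xs : Vec ℕ n) → ∀ q → All (_≤ v) q → Bounded f xs → Bounded f (refill v xs q)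
refill-bounded v<f [] q _ _ = tt
refill-bounded {v = v} v<f (x ∷ xs) q q≤v (x<f , xs<f) with x ≤? v
... | yes x≤v = ≤-<-trans (headOr-≤ q x≤v q≤v) (v<f Fin.zero) ,
                refill-bounded (v<f ∘ Fin.suc) xs (drop 1 q) (drop⁺ 1 q≤v) xs<f
... | no _ = x<f , refill-bounded (v<f ∘ Fin.suc) xs q q≤v xs<f

rotate : ∀ {n} → (ℕ → List ℕ → List ℕ) → ℕ → Vec ℕ n → Vec ℕ n
rotate s v [] = []
rotate s v (x ∷ xs) with v ≟ x
... | yes _ = x ∷ refill v xs (s v (low v xs))
... | no _ = x ∷ rotate s v xs

rotate-here : ∀ {n} s v (xs : Vec ℕ n) → rotate s v (v ∷ xs) ≡ v ∷ refill v xs (s v (low v xs))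
rotate-here s v xs with v ≟ v
... | yes _ = refl
... | no v≢v = contradiction refl v≢v

rotate-later : ∀ {n} s {v x} (xs : Vec ℕ n) → v ≢ x → rotate s v (x ∷ xs) ≡ x ∷ rotate s v xs
rotate-later s {v} {x} xs v≢x with v ≟ x
... | yes v≡x = contradiction v≡x v≢x
... | no _ = refl

module Rotation {s : ℕ → List ℕ → List ℕ} (reg : Regrouping s) where
  open Regrouping reg

  regroup-fits : ∀ {n} v (xs : Vec ℕ n) → Fits v xs (s v (low v xs))
  regroup-fits v xs = bound-regroup v _ (all-filter (_≤? v) (toList xs)) , length-regroup v _

  signature-rotate-other : ∀ {n u v} → u ≢ v → (e : Vec ℕ n) → signature u (rotate s v e) ≡ signature u e
  signature-rotate-other u≢v [] = refl
  signature-rotate-other {u = u} {v} u≢v (x ∷ xs) with v ≟ x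
  ... | no _ = signature-∷-cong u x (rotate s v xs) xs (signature-rotate-other u≢v xs)
  ... | yes refl = signature-∷-cong u v (refill v xs q) xs (afterRefill (<-cmp u v))
    where
    q : List ℕ
    q = s v (low v xs)
    afterRefill : Tri (u < v) (u ≡ v) (v < u) → signature u (refill v xs q) ≡ signature u xs
    afterRefill (tri< u<v _ _) = cong (map (u ≡ᵇ_)) (begin
      low u (refill v xs q) ≡⟨ low-refill-below u<v xs q (regroup-fits v xs) ⟩
      atMost u q            ≡⟨ below-regroup u<v (low v xs) ⟩
      atMost u (low v xs)   ≡⟨ atMost-atMost (<⇒≤ u<v) (toList xs) ⟩
      low u xs              ∎)
      where open ≡-Reasoning
    afterRefill (tri≈ _ u≡v _) = contradiction u≡v u≢v
    afterRefill (tri> _ _ v<u) = signature-refill-above v<u xs q (regroup-fits v xs .proj₁)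

  signature-rotate-self : ∀ {n} W v → (∀ w → W (map (v ≡ᵇ_) (s v w)) ≡ true) →
                          (e : Vec ℕ n) → afterFirstTrue W (signature v (rotate s v e)) ≡ true
  signature-rotate-self W v shape [] = refl
  signature-rotate-self W v shape (x ∷ xs) with v ≟ x
  ... | no v≢x = trans (afterFirstTrue-∷-other W (rotate s v xs) (v≢x ∘ sym)) (signature-rotate-self W v shape xs)
  ... | yes refl = begin
    afterFirstTrue W (signature v (v ∷ refill v xs q)) ≡⟨ cong (afterFirstTrue W) (signature-≡ v (refill v xs q)) ⟩
    W (map (v ≡ᵇ_) (low v (refill v xs q)))            ≡⟨ cong (W ∘ map (v ≡ᵇ_)) (low-refill v xs q (regroup-fits v xs)) ⟩
    W (map (v ≡ᵇ_) q)                                  ≡⟨ shape (low v xs) ⟩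
    true                                               ∎
    where
    open ≡-Reasoning
    q : List ℕ
    q = s v (low v xs)

  -- The v-rotation respects monotone bounds: the first v sits below its bound,
  -- so every later bound exceeds v.
  rotate-bounded : ∀ {n} {f : Fin n → ℕ} → Monotone f → ∀ v (e : Vec ℕ n) → Bounded f e → Bounded f (rotate s v e)
  rotate-bounded mono v [] _ = tt
  rotate-bounded mono v (x ∷ xs) (x<f , xs<f) with v ≟ x
  ... | no _ = x<f , rotate-bounded (λ i j i≤j → mono (Fin.suc i) (Fin.suc j) (s≤s i≤j)) v xs xs<f
  ... | yes refl = x<f , refill-bounded (λ i → <-≤-trans x<f (mono Fin.zero (Fin.suc i) z≤n))
                                        xs (s v (low v xs)) (regroup-fits v xs .proj₁) xs<f

rotate-inverse : ∀ {s t} → Regrouping s → Regrouping t → (W : List Bool → Bool) →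
                 (∀ v w → t v (s v w) ≡ t v w) → (∀ v w → W (map (v ≡ᵇ_) w) ≡ true → t v w ≡ w) →
                 ∀ {n} v (e : Vec ℕ n) → afterFirstTrue W (signature v e) ≡ true → rotate t v (rotate s v e) ≡ e
rotate-inverse regS regT W t∘s t-fixed v [] _ = refl
rotate-inverse {s} {t} regS regT W t∘s t-fixed v (x ∷ xs) h with v ≟ x
... | no v≢x = begin
  rotate t v (x ∷ rotate s v xs)   ≡⟨ rotate-later t (rotate s v xs) v≢x ⟩
  x ∷ rotate t v (rotate s v xs)   ≡⟨ cong (x ∷_) (rotate-inverse regS regT W t∘s t-fixed v xs h′) ⟩
  x ∷ xs                           ∎
  where
  open ≡-Reasoning
  h′ : afterFirstTrue W (signature v xs) ≡ true
  h′ = trans (sym (afterFirstTrue-∷-other W xs (v≢x ∘ sym))) h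
... | yes refl = begin
  rotate t v (v ∷ refill v xs q)              ≡⟨ rotate-here t v (refill v xs q) ⟩
  v ∷ refill v (refill v xs q) (t v (low v (refill v xs q)))
    ≡⟨ cong (λ z → v ∷ refill v (refill v xs q) (t v z)) (low-refill v xs q fitsS) ⟩
  v ∷ refill v (refill v xs q) (t v q)        ≡⟨ cong (v ∷_) (refill-refill v xs q (t v q) (fitsS .proj₁) fitsT) ⟩
  v ∷ refill v xs (t v q)                     ≡⟨ cong (λ z → v ∷ refill v xs z) (trans (t∘s v (low v xs)) (t-fixed v (low v xs) shapeW)) ⟩
  v ∷ refill v xs (low v xs)                  ≡⟨ cong (v ∷_) (refill-low v xs) ⟩
  v ∷ xs                                      ∎
  where
  open ≡-Reasoning
  q : List ℕ
  q = s v (low v xs)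
  fitsS : Fits v xs q
  fitsS = Rotation.regroup-fits regS v xs
  fitsT : Fits v xs (t v q)
  fitsT = Regrouping.bound-regroup regT v q (fitsS .proj₁) , trans (Regrouping.length-regroup regT v q) (fitsS .proj₂)
  shapeW : W (map (v ≡ᵇ_) (low v xs)) ≡ true
  shapeW = trans (cong (afterFirstTrue W) (sym (signature-≡ v xs))) h

-- Section 10.  Iterated rotations.

toward110 : ∀ {n} → ℕ → Vec ℕ n → Vec ℕ n
toward110 zero e = e
toward110 (suc N) e = rotate copiesLast N (toward110 N e)

toward101 : ∀ {n} → ℕ → Vec ℕ n → Vec ℕ n
toward101 zero e = e
toward101 (suc N) e = toward101 N (rotate copiesFirst N e)

module Rotation110 = Rotation copiesLast-regrouping
module Rotation101 = Rotation copiesFirst-regrouping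

toward110-bounded : ∀ {n} {f : Fin n → ℕ} → Monotone f → ∀ N e → Bounded f e → Bounded f (toward110 N e)
toward110-bounded mono zero e b = b
toward110-bounded mono (suc N) e b = Rotation110.rotate-bounded mono N (toward110 N e) (toward110-bounded mono N e b)

toward101-bounded : ∀ {n} {f : Fin n → ℕ} → Monotone f → ∀ N e → Bounded f e → Bounded f (toward101 N e)
toward101-bounded mono zero e b = b
toward101-bounded mono (suc N) e b = toward101-bounded mono N (rotate copiesFirst N e) (Rotation101.rotate-bounded mono N e b)

toward110-signature : ∀ {n} N u (e : Vec ℕ n) → N ≤ u → signature u (toward110 N e) ≡ signature u e
toward110-signature zero u e _ = refl
toward110-signature (suc N) u e N<u =
  trans (Rotation110.signature-rotate-other (>⇒≢ N<u) (toward110 N e)) (toward110-signature N u e (<⇒≤ N<u))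

toward101-signature : ∀ {n} N u (e : Vec ℕ n) → N ≤ u → signature u (toward101 N e) ≡ signature u e
toward101-signature zero u e _ = refl
toward101-signature (suc N) u e N<u =
  trans (toward101-signature N u (rotate copiesFirst N e) (<⇒≤ N<u)) (Rotation101.signature-rotate-other (>⇒≢ N<u) e)

-- Afterwards every u-signature with u < N has the target shape: the rotation at u
-- creates it, and the other rotations do not touch it.
toward110-shape : ∀ {n} N u (e : Vec ℕ n) → u < N → shape110 (signature u (toward110 N e)) ≡ true
toward110-shape (suc N) u e u<1+N with u ≟ N
... | yes refl = Rotation110.signature-rotate-self falsesThenTrues u (copiesLast-shape u) (toward110 u e)
... | no u≢N = trans (cong shape110 (Rotation110.signature-rotate-other u≢N (toward110 N e)))
                     (toward110-shape N u e (≤∧≢⇒< (≤-pred u<1+N) u≢N))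

toward101-shape : ∀ {n} N u (e : Vec ℕ n) → u < N → shape101 (signature u (toward101 N e)) ≡ true
toward101-shape (suc N) u e u<1+N with u ≟ N
... | yes refl = trans (cong shape101 (toward101-signature u u (rotate copiesFirst u e) ≤-refl))
                       (Rotation101.signature-rotate-self truesThenFalses u (copiesFirst-shape u) e)
... | no u≢N = toward101-shape N u (rotate copiesFirst N e) (≤∧≢⇒< (≤-pred u<1+N) u≢N)

toward101-toward110 : ∀ {n} N (e : Vec ℕ n) → (∀ v → v < N → shape101 (signature v e) ≡ true) →
                      toward101 N (toward110 N e) ≡ e
toward101-toward110 zero e _ = refl
toward101-toward110 (suc N) e h = begin
  toward101 N (rotate copiesFirst N (rotate copiesLast N (toward110 N e)))
    ≡⟨ cong (toward101 N) (rotate-inverse copiesLast-regrouping copiesFirst-regrouping truesThenFalses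
                             copiesFirst-copiesLast copiesFirst-fixed N (toward110 N e) shapeN) ⟩
  toward101 N (toward110 N e)
    ≡⟨ toward101-toward110 N e (λ v v<N → h v (m≤n⇒m≤1+n v<N)) ⟩
  e ∎
  where
  open ≡-Reasoning
  shapeN : shape101 (signature N (toward110 N e)) ≡ true
  shapeN = trans (cong shape101 (toward110-signature N N e ≤-refl)) (h N ≤-refl)

toward110-toward101 : ∀ {n} N (e : Vec ℕ n) → (∀ v → v < N → shape110 (signature v e) ≡ true) →
                      toward110 N (toward101 N e) ≡ e
toward110-toward101 zero e _ = refl
toward110-toward101 (suc N) e h = begin
  rotate copiesLast N (toward110 N (toward101 N (rotate copiesFirst N e)))
    ≡⟨ cong (rotate copiesLast N) (toward110-toward101 N (rotate copiesFirst N e) shapesBelow) ⟩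
  rotate copiesLast N (rotate copiesFirst N e)
    ≡⟨ rotate-inverse copiesFirst-regrouping copiesLast-regrouping falsesThenTrues
                      copiesLast-copiesFirst copiesLast-fixed N e (h N ≤-refl) ⟩
  e ∎
  where
  open ≡-Reasoning
  shapesBelow : ∀ v → v < N → shape110 (signature v (rotate copiesFirst N e)) ≡ true
  shapesBelow v v<N = trans (cong shape110 (Rotation101.signature-rotate-other (<⇒≢ v<N) e)) (h v (m≤n⇒m≤1+n v<N))

-- Section 11.  Inversion sequences.

positionBound : ∀ {n} → Fin n → ℕ
positionBound i = suc (toℕ i)

positionBound-monotone : ∀ {n} → Monotone (positionBound {n})
positionBound-monotone i j = s≤s

allBelow⇒bounded : ∀ {n} (f : Fin n → ℕ) (e : Vec ℕ n) → T (everyFin (λ i → lookup e i <ᵇ f i)) → Bounded f e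
allBelow⇒bounded f [] _ = tt
allBelow⇒bounded f (x ∷ xs) t with Equivalence.to T-∧ (subst T (allFin-suc (λ i → lookup (x ∷ xs) i <ᵇ f i)) t)
... | x<f , rest = <ᵇ⇒< x (f Fin.zero) x<f , allBelow⇒bounded (f ∘ Fin.suc) xs rest

bounded⇒allBelow : ∀ {n} (f : Fin n → ℕ) (e : Vec ℕ n) → Bounded f e → T (everyFin (λ i → lookup e i <ᵇ f i))
bounded⇒allBelow f [] _ = tt
bounded⇒allBelow f (x ∷ xs) (x<f , rest) =
  subst T (sym (allFin-suc (λ i → lookup (x ∷ xs) i <ᵇ f i)))
        (Equivalence.from T-∧ (<⇒<ᵇ x<f , bounded⇒allBelow (f ∘ Fin.suc) xs rest))

signature-above : ∀ {n} {f : Fin n → ℕ} {v} (e : Vec ℕ n) → Bounded f e → (∀ i → f i ≤ v) →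
                  allFalse (signature v e) ≡ true
signature-above [] _ _ = refl
signature-above {v = v} (x ∷ xs) (x<f , rest) f≤v
  rewrite signature-< v xs (<-≤-trans x<f (f≤v Fin.zero)) = signature-above xs rest (f≤v ∘ Fin.suc)

shapes-from-below : ∀ {n} W (e : Vec ℕ n) → Bounded positionBound e →
                    (∀ v → v < n → afterFirstTrue W (signature v e) ≡ true) → ∀ v → afterFirstTrue W (signature v e) ≡ true
shapes-from-below {n} W e bounded below v with v <? n
... | yes v<n = below v v<n
... | no v≮n = afterFirstTrue-allFalse W (signature v e) (signature-above e bounded (λ i → ≤-trans (toℕ<n i) (≮⇒≥ v≮n)))

I-≡ : ∀ {n} {P Q : Vec ℕ n → Bool} {x y : Σ (Vec ℕ n) (λ e → T (P e) × T (Q e))} →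
      proj₁ x ≡ proj₁ y → x ≡ y
I-≡ {x = e , p , q} {.e , p′ , q′} refl = cong₂ (λ a b → e , a , b) (T-irrelevant p p′) (T-irrelevant q q′)

to110 : ∀ {n} → I[101] n → I[110] n
to110 {n} (e , isInv , _) = e′ , bounded⇒allBelow positionBound e′ bounded′ , Equivalence.from T-not-≡ avoids
  where
  e′ : Vec ℕ n
  e′ = toward110 n e
  bounded′ : Bounded positionBound e′
  bounded′ = toward110-bounded positionBound-monotone n e (allBelow⇒bounded positionBound e isInv)
  avoids : contains110 e′ ≡ false
  avoids = Avoid110.shape⇒avoids e′ (shapes-from-below falsesThenTrues e′ bounded′ (λ v → toward110-shape n v e))

to101 : ∀ {n} → I[110] n → I[101] n
to101 {n} (e , isInv , _) = e′ , bounded⇒allBelow positionBound e′ bounded′ , Equivalence.from T-not-≡ avoids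
  where
  e′ : Vec ℕ n
  e′ = toward101 n e
  bounded′ : Bounded positionBound e′
  bounded′ = toward101-bounded positionBound-monotone n e (allBelow⇒bounded positionBound e isInv)
  avoids : contains101 e′ ≡ false
  avoids = Avoid101.shape⇒avoids e′ (shapes-from-below truesThenFalses e′ bounded′ (λ v → toward101-shape n v e))

to110-to101 : ∀ {n} (y : I[110] n) → to110 (to101 y) ≡ y
to110-to101 {n} (e , _ , avoids) =
  I-≡ (toward110-toward101 n e (λ v _ → Avoid110.avoids⇒shape e (Equivalence.to T-not-≡ avoids) v))

to101-to110 : ∀ {n} (x : I[101] n) → to101 (to110 x) ≡ x
to101-to110 {n} (e , _ , avoids) =
  I-≡ (toward101-toward110 n e (λ v _ → Avoid101.avoids⇒shape e (Equivalence.to T-not-≡ avoids) v))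

-- Theorem 13.
theorem13 : (n : ℕ) → n ≥ 1 → I[101] n ↔ I[110] n
theorem13 n _ = mk↔ₛ′ to110 to101 to110-to101 to101-to110
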